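{- Let $t$ be a term. (1) If $t$ is $\bar{\mathsf{sh}}$-normal then $\|t\|=\min\{|\pi|\mid\pi \text{ a derivation of } t\}$. (2) If $t$ is a value then $\|t\|=\min\{|\pi|\mid\pi\text{ a derivation of } t\}=0$.
   Context: Terms: $t ::= x \mid \lambda x.t \mid tu$ up to $\alpha$-conversion; values are variables and abstractions. Balanced contexts: $B ::= [\cdot] \mid (\lambda x.B)t \mid Bt \mid tB$. Root rules: $(\lambda x.t)v \mapsto_{\beta_v} t\{v/x\}$ ($v$ value); $(\lambda x.t)us \mapsto_{\sigma_1} (\lambda x.ts)u$ if $x\notin\mathrm{fv}(s)$; $v((\lambda x.s)u) \mapsto_{\sigma_3} (\lambda x.vs)u$ if $v$ value and $x\notin\mathrm{fv}(v)$. $\to_{\bar{\mathsf{sh}}}$ is the closure of their union under balanced contexts; $\bar{\mathsf{sh}}$-normal means no such step applies. Balanced size: $\|v\|=0$ for $v$ a value; $\|tu\|=\|s\|+\|u\|+1$ if $t=\lambda x.s$, and $\|tu\|=\|t\|+\|u\|+1$ otherwise. Types: negative $N ::= P\multimap Q$; positive $P,Q ::= [N_1,\dots,N_n]$ finite multisets ($n\ge0$), $\mathbf{0}$ the empty multiset. Environments: maps from variables to positive types, $\mathbf{0}$ almost everywhere; $\uplus$ pointwise multiset sum. Rules: (ax) $x\colon P\vdash x\colon P$; (@) from $\Gamma\vdash t\colon[P\multimap Q]$ and $\Gamma'\vdash u\colon P$ infer $\Gamma\uplus\Gamma'\vdash tu\colon Q$; ($\lambda$) for $n\ge0$, from $\Gamma_i,x\colon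 P_i\vdash t\colon Q_i$ ($1\le i\le n$) infer $\biguplus_i\Gamma_i\vdash\lambda x.t\colon[P_1\multimap Q_1,\dots,P_n\multimap Q_n]$. A derivation of $t$ is one with conclusion $\Gamma\vdash t\colon P$ for some $\Gamma,P$; $|\pi|$ is its number of (@) rules. -}

module Defs where

open import Data.Nat using (ℕ; zero; suc; _+_; _≤_; _≟_)
open import Data.List using (List; []; _∷_; [_]; _++_)
open import Data.Product using (Σ; ∃; _×_; _,_)
open import Relation.Nullary using (¬_; yes; no)
open import Relation.Binary.PropositionalEquality using (_≡_)

infixl 7 _·_
data Tm : Set where
  var : ℕ → Tm
  ƛ_  : Tm → Tm
  _·_ : Tm → Tm → Tm

data Value : Tm → Set where
  var-val : ∀ x → Value (var x)
  lam-val : ∀ t → Value (ƛ t)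

ext : (ℕ → ℕ) → ℕ → ℕ
ext ρ zero    = zero
ext ρ (suc i) = suc (ρ i)

rename : (ℕ → ℕ) → Tm → Tm
rename ρ (var i) = var (ρ i)
rename ρ (ƛ t)   = ƛ rename (ext ρ) t
rename ρ (t · u) = rename ρ t · rename ρ u

shift : Tm → Tm
shift = rename suc

exts : (ℕ → Tm) → ℕ → Tm
exts σ zero    = var zero
exts σ (suc i) = shift (σ i)

subst : (ℕ → Tm) → Tm → Tm
subst σ (var i) = σ i
subst σ (ƛ t)   = ƛ subst (exts σ) t
subst σ (t · u) = subst σ t · subst σ u

-- t{v/x} where x is the bound variable 0
subst0 : Tm → Tm → Tm
subst0 t v = subst σ t
  where
  σ : ℕ → Tm
  σ zero    = v
  σ (suc i) = var i

-- Root rules and closure under balanced contexts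
-- (freshness side conditions are realised by shifting)

data _↦_ : Tm → Tm → Set where
  βv : ∀ {t v} → Value v → ((ƛ t) · v) ↦ (subst0 t v)
  σ₁ : ∀ {t u s} → ((ƛ t) · u · s) ↦ ((ƛ (t · shift s)) · u)
  σ₃ : ∀ {v s u} → Value v → (v · ((ƛ s) · u)) ↦ ((ƛ (shift v · s)) · u)

data _⟶sh_ : Tm → Tm → Set where
  root   : ∀ {t u} → t ↦ u → t ⟶sh u
  lamApp : ∀ {t t' s} → t ⟶sh t' → ((ƛ t) · s) ⟶sh ((ƛ t') · s)
  appL   : ∀ {t t' s} → t ⟶sh t' → (t · s) ⟶sh (t' · s)
  appR   : ∀ {t s s'} → s ⟶sh s' → (t · s) ⟶sh (t · s')

ShNormal : Tm → Set
ShNormal t = ∀ u → ¬ (t ⟶sh u)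

bsize : Tm → ℕ
bsize (var x)       = 0
bsize (ƛ t)         = 0
bsize ((ƛ s) · u)   = bsize s + bsize u + 1
bsize (var x · u)   = bsize (var x) + bsize u + 1
bsize ((t · t') · u) = bsize (t · t') + bsize u + 1

-- Types: positive types are finite multisets, represented by lists;
-- multiset equality is the (deep) permutation equivalence _≈P_.

data Neg : Set where
  _⊸_ : List Neg → List Neg → Neg

Pos : Set
Pos = List Neg

𝟎 : Pos
𝟎 = []

data _≈N_ : Neg → Neg → Set
data _≈P_ : Pos → Pos → Set

data _≈N_ where
  ⊸-cong : ∀ {P P' Q Q'} → P ≈P P' → Q ≈P Q' → (P ⊸ Q) ≈N (P' ⊸ Q')

data _≈P_ where
  []≈   : [] ≈P []
  cons≈ : ∀ {N N' P P'} → N ≈N N' → P ≈P P' → (N ∷ P) ≈P (N' ∷ P')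
  swap≈ : ∀ {N M P} → (N ∷ M ∷ P) ≈P (M ∷ N ∷ P)
  trans≈ : ∀ {P Q R} → P ≈P Q → Q ≈P R → P ≈P R

Env : Set
Env = ℕ → Pos

𝟎ₑ : Env
𝟎ₑ _ = 𝟎

_⊎ₑ_ : Env → Env → Env
(Γ ⊎ₑ Δ) i = Γ i ++ Δ i

single : ℕ → Pos → Env
single x P i with i ≟ x
... | yes _ = P
... | no  _ = 𝟎

tailₑ : Env → Env
tailₑ Γ i = Γ (suc i)

-- Derivations.  The (λ) rule with n premises Γᵢ , x : Pᵢ ⊢ t : Qᵢ is
-- encoded by the list-of-premises family _⊩λ_∶_.

data _⊢_∶_ : Env → Tm → Pos → Set
data _⊩λ_∶_ : Env → Tm → Pos → Set

data _⊢_∶_ where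
  ax  : ∀ x P → single x P ⊢ var x ∶ P
  app : ∀ {Γ Γ' t u P P' Q} →
        Γ ⊢ t ∶ [ P ⊸ Q ] → Γ' ⊢ u ∶ P' → P' ≈P P →
        (Γ ⊎ₑ Γ') ⊢ (t · u) ∶ Q
  lam : ∀ {Γ t L} → Γ ⊩λ t ∶ L → Γ ⊢ (ƛ t) ∶ L

data _⊩λ_∶_ where
  nil  : ∀ {t} → 𝟎ₑ ⊩λ t ∶ []
  cons : ∀ {Γ Δ t Q L} → Γ ⊢ t ∶ Q → Δ ⊩λ t ∶ L →
         (tailₑ Γ ⊎ₑ Δ) ⊩λ t ∶ ((Γ 0 ⊸ Q) ∷ L)

∣_∣ : ∀ {Γ t P} → Γ ⊢ t ∶ P → ℕ
∣_∣λ : ∀ {Γ t P} → Γ ⊩λ t ∶ P → ℕ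
∣ ax x P ∣ = 0
∣ app π π' _ ∣ = ∣ π ∣ + ∣ π' ∣ + 1
∣ lam ρ ∣ = ∣ ρ ∣λ
∣ nil ∣λ = 0
∣ cons π ρ ∣λ = ∣ π ∣ + ∣ ρ ∣λ

Derivation : Tm → Set
Derivation t = Σ Env λ Γ → Σ Pos λ P → Γ ⊢ t ∶ P

size : ∀ {t} → Derivation t → ℕ
size (_ , _ , π) = ∣ π ∣

IsMinDerivSize : Tm → ℕ → Set
IsMinDerivSize t n = (Σ (Derivation t) λ π → size π ≡ n) × (∀ (π : Derivation t) → n ≤ size π)

-- Lower bound: every application contributes an (@) rule, and in a β-shaped
-- application (λx.s)u the abstraction is typed by a singleton [P ⊸ Q], so its
-- derivation contains one of s.  Upper bound: an sh-normal term is a value, a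
-- neutral term x u₁ … uₙ with normal arguments, or (λx.s)u with s normal and
-- u neutral; neutral terms are typable at every type with exactly ‖·‖ (@)
-- rules, so u can be given whatever type the derivation of s assigns to x.
module Submission where

open import Defs
open import Data.Product using (_×_; Σ; _,_)
open import Relation.Binary.PropositionalEquality using (_≡_; refl; sym; trans; cong₂)
open import Data.Nat using (_+_; _≤_; z≤n)
open import Data.Nat.Properties using (+-mono-≤; +-monoˡ-≤; ≤-trans; m≤m+n; +-identityʳ)
open import Data.List using ([]; _∷_; [_])
open import Relation.Nullary using (contradiction)

≈N-refl : ∀ N → N ≈N N
≈P-refl : ∀ P → P ≈P P
≈N-refl (P ⊸ Q) = ⊸-cong (≈P-refl P) (≈P-refl Q)
≈P-refl []      = []≈
≈P-refl (N ∷ P) = cons≈ (≈N-refl N) (≈P-refl P)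

bsize≤∣π∣ : ∀ {Γ t P} (π : Γ ⊢ t ∶ P) → bsize t ≤ ∣ π ∣
bsize≤∣π∣ (ax x P) = z≤n
bsize≤∣π∣ (lam ρ)  = z≤n
bsize≤∣π∣ (app {t = ƛ s} (lam (cons πs ρ)) πu _) =
  +-monoˡ-≤ 1 (+-mono-≤ (≤-trans (bsize≤∣π∣ πs) (m≤m+n ∣ πs ∣ ∣ ρ ∣λ)) (bsize≤∣π∣ πu))
bsize≤∣π∣ (app {t = var x} πa πu _) = +-monoˡ-≤ 1 (+-mono-≤ z≤n (bsize≤∣π∣ πu))
bsize≤∣π∣ (app {t = a · b} πa πu _) = +-monoˡ-≤ 1 (+-mono-≤ (bsize≤∣π∣ πa) (bsize≤∣π∣ πu))

ShNormal-value : ∀ {t} → Value t → ShNormal t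
ShNormal-value (var-val x) _ (root ())
ShNormal-value (lam-val t) _ (root ())

ShNormal-appL : ∀ {a u} → ShNormal (a · u) → ShNormal a
ShNormal-appL n _ r = n _ (appL r)

ShNormal-appR : ∀ {a u} → ShNormal (a · u) → ShNormal u
ShNormal-appR n _ r = n _ (appR r)

ShNormal-lamApp : ∀ {s u} → ShNormal ((ƛ s) · u) → ShNormal s
ShNormal-lamApp n _ r = n _ (lamApp r)

data Neutral : Tm → Set where
  var : ∀ x → Neutral (var x)
  _·_ : ∀ {a} → Neutral a → ∀ u → Neutral (a · u)

bsize-neutral-· : ∀ {a} → Neutral a → ∀ u → bsize (a · u) ≡ bsize a + bsize u + 1
bsize-neutral-· (var x) u = refl
bsize-neutral-· (na · b) u = refl

bsize-value : ∀ {t} → Value t → bsize t ≡ 0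
bsize-value (var-val x) = refl
bsize-value (lam-val t) = refl

ShNormal-head-neutral : ∀ a b {u} → ShNormal (a · b · u) → Neutral (a · b)
ShNormal-head-neutral (var x) b n = var x · b
ShNormal-head-neutral (ƛ r) b n   = contradiction (root σ₁) (n _)
ShNormal-head-neutral (a · a') b n = ShNormal-head-neutral a a' (ShNormal-appL n) · b

ShNormal-redex-arg-neutral : ∀ s u → ShNormal ((ƛ s) · u) → Neutral u
ShNormal-redex-arg-neutral s (var x) n        = var x
ShNormal-redex-arg-neutral s (ƛ r) n          = contradiction (root (βv (lam-val r))) (n _)
ShNormal-redex-arg-neutral s (var x · c) n    = var x · c
ShNormal-redex-arg-neutral s ((ƛ r) · c) n    = contradiction (root (σ₃ (lam-val s))) (n _)
ShNormal-redex-arg-neutral s ((a · b) · c) n  =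
  ShNormal-head-neutral a b (ShNormal-appR n) · c

BalancedDerivation : Tm → Pos → Set
BalancedDerivation t Q = Σ Env λ Γ → Σ (Γ ⊢ t ∶ Q) λ π → ∣ π ∣ ≡ bsize t

balanced-neutral-app : ∀ {a P Q} → Neutral a → ∀ u →
  BalancedDerivation a [ P ⊸ Q ] → BalancedDerivation u P → BalancedDerivation (a · u) Q
balanced-neutral-app {P = P} na u (_ , πa , ea) (_ , πu , eu) =
  _ , app πa πu (≈P-refl P) , trans (cong₂ (λ m k → m + k + 1) ea eu) (sym (bsize-neutral-· na u))

balanced-neutral : ∀ {t} → Neutral t → ShNormal t → ∀ Q → BalancedDerivation t Q
balanced-normal  : ∀ t → ShNormal t → Σ _ (BalancedDerivation t)

balanced-neutral (var x) n Q = _ , ax x Q , refl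
balanced-neutral (na · u) n Q =
  let P , du = balanced-normal u (ShNormal-appR n) in
  balanced-neutral-app na u (balanced-neutral na (ShNormal-appL n) [ P ⊸ Q ]) du

balanced-normal (var x) n = [] , _ , ax x [] , refl
balanced-normal (ƛ t) n   = [] , _ , lam nil , refl
balanced-normal (var x · u) n = [] , balanced-neutral (var x · u) n []
balanced-normal ((a · b) · u) n = [] , balanced-neutral (ShNormal-head-neutral a b n · u) n []
balanced-normal ((ƛ s) · u) n
  with balanced-normal s (ShNormal-lamApp n)
... | Q , Γ , πs , es
  with balanced-neutral (ShNormal-redex-arg-neutral s u n) (ShNormal-appR n) (Γ 0)
... | _ , πu , eu =
  Q , _ , app (lam (cons πs nil)) πu (≈P-refl (Γ 0)) ,
  cong₂ (λ m k → m + k + 1) (trans (+-identityʳ ∣ πs ∣) es) eu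

lemma5p2 : (∀ t → ShNormal t → IsMinDerivSize t (bsize t))
    × (∀ t → Value t → IsMinDerivSize t (bsize t) × bsize t ≡ 0)
lemma5p2 = normal-min , λ t v → normal-min t (ShNormal-value v) , bsize-value v
  where
  normal-min : ∀ t → ShNormal t → IsMinDerivSize t (bsize t)
  normal-min t n =
    let P , Γ , π , e = balanced-normal t n in
    ((Γ , P , π) , e) , λ { (_ , _ , π′) → bsize≤∣π∣ π′ }
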